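{- Let $n$ be a positive even integer. The following are equivalent: (i) for every integer $j>0$, the orbit of the constant sequence $1^{2j-1}$ (of length $2j-1$) under the permutation $u\mapsto C_{1,n}((1),u)$ of $\{1,n\}^{2j-1}$ has length exactly $2^j$; (ii) for every integer $j>0$, the sequence $E_{1,n}\left(1^{2^j},1^{2j}\right)$ has odd length.
   Context: For a sequence $s$, $R(s)$ denotes the sequence of run lengths of $s$ (the lengths of the maximal blocks of consecutive equal terms, in order). $x^p$ denotes the sequence of length $p$ all of whose terms equal $x$. Let $m\neq n$ be positive integers. For a sequence $s$ of positive integers and a finite nonempty sequence $t=(t_1,\dots,t_k)$ with values in $\{m,n\}$, the expansion $E_{m,n}(s,t)$ is defined recursively: if $k=1$, $E_{m,n}(s,t)$ is the unique sequence with values in $\{m,n\}$ whose first term is $t_1$ and with $R(E_{m,n}(s,t))=s$; if $k>1$, $E_{m,n}(s,t)=E_{m,n}(E_{m,n}(s,(t_1)),(t_2,\dots,t_k))$. For a finite nonempty sequence $s$ of positive integers and $t\in\{m,n\}^k$, $C_{m,n}(s,t)$ is the sequence of length $k$ whose $i$-th term equals $m+n$ minus the last term of $E_{m,n}(s,(t_1,\dots,t_i))$; the map $u\mapsto C_{m,n}(s,u)$ is a bijection of $\{m,n\}^k$. -}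

module Defs where

open import Data.Nat using (ℕ; zero; suc; _+_; _∸_; _≤_; _<_)
open import Data.List using (List; []; _∷_; _++_; replicate; map; take; length; applyUpTo)
open import Relation.Binary.PropositionalEquality using (_≡_)
open import Relation.Nullary using (¬_)

-- E1 m n x s : the unique sequence with values in {m,n}, first term x
-- (assumed ∈ {m,n}), whose run-length sequence is s (s positive):
-- blocks of lengths s₁, s₂, … alternating between x and the other letter.
E1 : ℕ → ℕ → ℕ → List ℕ → List ℕ
E1 m n x []      = []
E1 m n x (k ∷ s) = replicate k x ++ E1 m n ((m + n) ∸ x) s

E : ℕ → ℕ → List ℕ → List ℕ → List ℕ
E m n s []       = s
E m n s (t ∷ ts) = E m n (E1 m n t s) ts

-- last term of a list (default 0 for the empty list; never used on empty lists here)
lastD : List ℕ → ℕ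
lastD []           = 0
lastD (x ∷ [])     = x
lastD (x ∷ y ∷ xs) = lastD (y ∷ xs)

C : ℕ → ℕ → List ℕ → List ℕ → List ℕ
C m n s t = map (λ i → (m + n) ∸ lastD (E m n s (take i t))) (applyUpTo suc (length t))

iter : {A : Set} → (A → A) → ℕ → A → A
iter f zero    x = x
iter f (suc p) x = f (iter f p x)

OrbitLength : {A : Set} → (A → A) → A → ℕ → Set
OrbitLength f x L = (0 < L) × (iter f L x ≡ x) × (∀ p → 0 < p → p < L → ¬ (iter f p x ≡ x))
  where open import Data.Product using (_×_)

-- Let T = C_{1,n}((1), ·) and write 1^k for the constant word of length k. Expanding along
-- u followed by c is expanding along u and then along c, so T acts on u followed by c as on
-- u, followed by c complemented (x ↦ 1 + n − x) once for each letter of E_{1,n}((1), u).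
-- Hence T^p(1^{k+1}) is T^p(1^k) followed by 1 complemented f_k(0) + … + f_k(p − 1) times,
-- where f_k(q) = |E_{1,n}((1), T^q(1^k))|. So 1^{k+1} returns exactly when 1^k does and that
-- sum is even; f_k being periodic with the period P_k of 1^k, the period of 1^{k+1} is P_k or
-- 2P_k according to the parity of f_k(0) + … + f_k(P_k − 1). Since E_{1,n}(1^N, t) is the
-- concatenation of the E_{1,n}((1), T^q t) for q < N, that parity is the parity of
-- |E_{1,n}(1^{P_k}, 1^k)|. After a doubling, f_{k+1} is summed over two of its periods, so a
-- doubling step is always followed by a non-doubling one. Both (i) and (ii) therefore say that
-- the period doubles at every step from 2j to 2j + 1, when it equals 2^j.
-- That n is even is used only to exclude n = 1.
module Submission where

open import Defs
open import Data.Nat using (ℕ; parity; zero; suc; _+_; _*_; _∸_; _^_; _<_; z≤n; s≤s; >-nonZero)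
open import Data.Nat.Properties
  using (+-comm; +-assoc; m≤m+n; *-assoc; *-suc; m+n∸n≡m; ≤-antisym; ≮⇒≥; <-irrefl; <-≤-trans;
         >⇒≢; ^-monoʳ-<; n<1+n)
open import Data.Nat.Divisibility using (_∣_; divides; ∣⇒≤; ∣-refl; 1∣_)
open import Data.Nat.ListAction using (sum)
open import Data.Parity.Base as ℙ using (Parity; 0ℙ; 1ℙ)
open import Data.Parity.Properties as ℙₚ using (*-homo-*)
open import Data.List using (List; []; _∷_; _++_; _∷ʳ_; replicate; length; map; take; applyUpTo)
open import Data.List.Properties using (length-++; length-replicate; ++-assoc; ∷ʳ-injective)
open import Data.List.Relation.Unary.All as All using (All; []; _∷_)
open import Data.List.Relation.Unary.All.Properties using (++⁺; replicate⁺)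
open import Data.Product using (_×_; _,_; proj₁; proj₂)
open import Data.Product.Function.NonDependent.Propositional using (_×-⇔_)
open import Data.Sum using (_⊎_; inj₁; inj₂)
open import Function.Bundles using (_⇔_; mk⇔; Equivalence)
open import Function.Properties.Equivalence using () renaming (refl to ⇔-refl; trans to ⇔-trans)
open import Relation.Nullary using (¬_; contradiction)
open import Relation.Binary.PropositionalEquality
open ≡-Reasoning

sumUpTo : (ℕ → ℕ) → ℕ → ℕ
sumUpTo f zero    = 0
sumUpTo f (suc p) = f 0 + sumUpTo (λ q → f (suc q)) p

sumUpTo-+ : ∀ f a b → sumUpTo f (a + b) ≡ sumUpTo f a + sumUpTo (λ q → f (a + q)) b
sumUpTo-+ f zero    b = refl
sumUpTo-+ f (suc a) b = begin
  f 0 + sumUpTo (λ q → f (suc q)) (a + b)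
    ≡⟨ cong (f 0 +_) (sumUpTo-+ (λ q → f (suc q)) a b) ⟩
  f 0 + (sumUpTo (λ q → f (suc q)) a + sumUpTo (λ q → f (suc a + q)) b)
    ≡⟨ +-assoc (f 0) _ _ ⟨
  sumUpTo f (suc a) + sumUpTo (λ q → f (suc a + q)) b ∎

sumUpTo-suc : ∀ f p → sumUpTo f (suc p) ≡ sumUpTo f p + f p
sumUpTo-suc f p = begin
  sumUpTo f (suc p)             ≡⟨ cong (sumUpTo f) (+-comm 1 p) ⟩
  sumUpTo f (p + 1)             ≡⟨ sumUpTo-+ f p 1 ⟩
  sumUpTo f p + (f (p + 0) + 0) ≡⟨ cong (λ x → sumUpTo f p + (f x + 0)) (+-comm p 0) ⟩
  sumUpTo f p + (f p + 0)       ≡⟨ cong (sumUpTo f p +_) (+-comm (f p) 0) ⟩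
  sumUpTo f p + f p             ∎

sumUpTo-cong : ∀ {f g} → (∀ q → f q ≡ g q) → ∀ p → sumUpTo f p ≡ sumUpTo g p
sumUpTo-cong f≗g zero    = refl
sumUpTo-cong f≗g (suc p) = cong₂ _+_ (f≗g 0) (sumUpTo-cong (λ q → f≗g (suc q)) p)

sumUpTo-periodic : ∀ {f P} → (∀ q → f (P + q) ≡ f q) → ∀ m →
  sumUpTo f (m * P) ≡ m * sumUpTo f P
sumUpTo-periodic         per zero    = refl
sumUpTo-periodic {f} {P} per (suc m) = begin
  sumUpTo f (P + m * P)                           ≡⟨ sumUpTo-+ f P (m * P) ⟩
  sumUpTo f P + sumUpTo (λ q → f (P + q)) (m * P) ≡⟨ cong (sumUpTo f P +_) (sumUpTo-cong per (m * P)) ⟩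
  sumUpTo f P + sumUpTo f (m * P)                 ≡⟨ cong (sumUpTo f P +_) (sumUpTo-periodic per m) ⟩
  sumUpTo f P + m * sumUpTo f P                   ∎

parity≡0ℙ⇒2∣ : ∀ m → parity m ≡ 0ℙ → 2 ∣ m
parity≡0ℙ⇒2∣ zero          _  = divides 0 refl
parity≡0ℙ⇒2∣ (suc (suc m)) eq with parity≡0ℙ⇒2∣ m eq
... | divides q m≡q*2 = divides (suc q) (cong (λ x → suc (suc x)) m≡q*2)

2∣⇒parity≡0ℙ : ∀ {m} → 2 ∣ m → parity m ≡ 0ℙ
2∣⇒parity≡0ℙ (divides q refl) = trans (*-homo-* q 2) (ℙₚ.*-zeroʳ (parity q))

¬2∣⇒parity≡1ℙ : ∀ {m} → ¬ 2 ∣ m → parity m ≡ 1ℙ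
¬2∣⇒parity≡1ℙ {m} 2∤m with parity m in eq
... | 1ℙ = refl
... | 0ℙ = contradiction (parity≡0ℙ⇒2∣ m eq) 2∤m

parity-sumUpTo-periodic : ∀ {f P} → (∀ q → f (P + q) ≡ f q) → ∀ m →
  parity (sumUpTo f (m * P)) ≡ parity m ℙ.* parity (sumUpTo f P)
parity-sumUpTo-periodic {f} {P} per m = begin
  parity (sumUpTo f (m * P))        ≡⟨ cong parity (sumUpTo-periodic per m) ⟩
  parity (m * sumUpTo f P)          ≡⟨ *-homo-* m _ ⟩
  parity m ℙ.* parity (sumUpTo f P) ∎

scale : Parity → ℕ → ℕ
scale 0ℙ P = P
scale 1ℙ P = 2 * P

multiple-with-even-sum⇔ : ∀ {f P} → (∀ q → f (P + q) ≡ f q) → ∀ p →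
  (P ∣ p × parity (sumUpTo f p) ≡ 0ℙ) ⇔ scale (parity (sumUpTo f P)) P ∣ p
multiple-with-even-sum⇔ {f} {P} per p with parity (sumUpTo f P) in eq
... | 0ℙ = mk⇔ proj₁ λ where
  P∣p@(divides m refl) → P∣p , trans (parity-sumUpTo-periodic per m)
                                      (trans (cong (parity m ℙ.*_) eq) (ℙₚ.*-zeroʳ (parity m)))
... | 1ℙ = mk⇔ to from
  where
  sumParity : ∀ m → parity (sumUpTo f (m * P)) ≡ parity m
  sumParity m = trans (parity-sumUpTo-periodic per m)
                      (trans (cong (parity m ℙ.*_) eq) (ℙₚ.*-identityʳ (parity m)))
  to : P ∣ p × parity (sumUpTo f p) ≡ 0ℙ → 2 * P ∣ p
  to (divides m refl , even) with parity≡0ℙ⇒2∣ m (trans (sym (sumParity m)) even)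
  ... | divides q refl = divides q (*-assoc q 2 P)
  from : 2 * P ∣ p → P ∣ p × parity (sumUpTo f p) ≡ 0ℙ
  from (divides q refl) rewrite sym (*-assoc q 2 P) =
    divides (q * 2) refl , trans (sumParity (q * 2)) (2∣⇒parity≡0ℙ (divides q refl))

iter-+ : ∀ {A : Set} (f : A → A) a b x → iter f (a + b) x ≡ iter f a (iter f b x)
iter-+ f zero    b x = refl
iter-+ f (suc a) b x = cong f (iter-+ f a b x)

iter-shift : ∀ {A : Set} (f : A → A) p x → iter f p (f x) ≡ iter f (suc p) x
iter-shift f zero    x = refl
iter-shift f (suc p) x = cong f (iter-shift f p x)

iter-periodic : ∀ {A : Set} {f : A → A} {x} P → iter f P x ≡ x →
  ∀ q → iter f (P + q) x ≡ iter f q x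
iter-periodic {f = f} {x} P returns q = begin
  iter f (P + q) x      ≡⟨ cong (λ r → iter f r x) (+-comm P q) ⟩
  iter f (q + P) x      ≡⟨ iter-+ f q P x ⟩
  iter f q (iter f P x) ≡⟨ cong (iter f q) returns ⟩
  iter f q x            ∎

orbitLength⇔ : ∀ {A : Set} {f : A → A} {x P} → 0 < P → (∀ p → iter f p x ≡ x ⇔ P ∣ p) →
  ∀ L → OrbitLength f x L ⇔ L ≡ P
orbitLength⇔ {f = f} {x} {P} 0<P returns⇔ L = mk⇔ to from
  where
  returnsAtP : iter f P x ≡ x
  returnsAtP = Equivalence.from (returns⇔ P) ∣-refl
  to : OrbitLength f x L → L ≡ P
  to (0<L , returnsAtL , minimal) = ≤-antisym
    (≮⇒≥ λ P<L → minimal P 0<P P<L returnsAtP)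
    (∣⇒≤ {{>-nonZero 0<L}} (Equivalence.to (returns⇔ L) returnsAtL))
  from : L ≡ P → OrbitLength f x L
  from refl = 0<P , returnsAtP , λ p 0<p p<P returns →
    <-irrefl refl (<-≤-trans p<P (∣⇒≤ {{>-nonZero 0<p}} (Equivalence.to (returns⇔ p) returns)))

map-applyUpTo : ∀ {A B : Set} (g : A → B) (f : ℕ → A) k →
  map g (applyUpTo f k) ≡ applyUpTo (λ i → g (f i)) k
map-applyUpTo g f zero    = refl
map-applyUpTo g f (suc k) = cong (g (f 0) ∷_) (map-applyUpTo g (λ i → f (suc i)) k)

replicate-suc-∷ʳ : ∀ {A : Set} k (x : A) → replicate (suc k) x ≡ replicate k x ∷ʳ x
replicate-suc-∷ʳ zero    x = refl
replicate-suc-∷ʳ (suc k) x = cong (x ∷_) (replicate-suc-∷ʳ k x)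

lastD-++-∷ : ∀ (xs : List ℕ) y ys → lastD (xs ++ y ∷ ys) ≡ lastD (y ∷ ys)
lastD-++-∷ []            y ys = refl
lastD-++-∷ (x ∷ [])      y ys = refl
lastD-++-∷ (x ∷ x′ ∷ xs) y ys = lastD-++-∷ (x′ ∷ xs) y ys

lastD-replicate : ∀ k (c : ℕ) → lastD (replicate (suc k) c ++ []) ≡ c
lastD-replicate zero    c = refl
lastD-replicate (suc k) c = lastD-replicate k c

module Expansion (m n : ℕ) where

  complement : ℕ → ℕ
  complement c = (m + n) ∸ c

  E-[] : ∀ t → E m n [] t ≡ []
  E-[] []      = refl
  E-[] (c ∷ t) = E-[] t

  E-∷ʳ : ∀ s u c → E m n s (u ∷ʳ c) ≡ E1 m n c (E m n s u)
  E-∷ʳ s []       c = refl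
  E-∷ʳ s (c′ ∷ u) c = E-∷ʳ (E1 m n c′ s) u c

  length-E1 : ∀ c s → length (E1 m n c s) ≡ sum s
  length-E1 c []      = refl
  length-E1 c (k ∷ s) = begin
    length (replicate k c ++ E1 m n (complement c) s)
      ≡⟨ length-++ (replicate k c) ⟩
    length (replicate k c) + length (E1 m n (complement c) s)
      ≡⟨ cong₂ _+_ (length-replicate k) (length-E1 (complement c) s) ⟩
    k + sum s ∎

  E1-++ : ∀ c s s′ → E1 m n c (s ++ s′) ≡ E1 m n c s ++ E1 m n (iter complement (length s) c) s′
  E1-++ c []      s′ = refl
  E1-++ c (k ∷ s) s′ = begin
    replicate k c ++ E1 m n (complement c) (s ++ s′)
      ≡⟨ cong (replicate k c ++_) (E1-++ (complement c) s s′) ⟩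
    replicate k c ++ (E1 m n (complement c) s ++ E1 m n (iter complement (length s) (complement c)) s′)
      ≡⟨ cong (λ c′ → replicate k c ++ (E1 m n (complement c) s ++ E1 m n c′ s′))
              (iter-shift complement (length s) c) ⟩
    replicate k c ++ (E1 m n (complement c) s ++ E1 m n (iter complement (length (k ∷ s)) c) s′)
      ≡⟨ ++-assoc (replicate k c) _ _ ⟨
    E1 m n c (k ∷ s) ++ E1 m n (iter complement (length (k ∷ s)) c) s′ ∎

  lastD-E1 : ∀ c k s → All (0 <_) (k ∷ s) → lastD (E1 m n c (k ∷ s)) ≡ iter complement (length s) c
  lastD-E1 c zero    _            (() ∷ _)
  lastD-E1 c (suc k) []           _             = lastD-replicate k c
  lastD-E1 c (suc k) (zero ∷ s)   (_ ∷ () ∷ _)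
  lastD-E1 c (suc k) (suc k′ ∷ s) (_ ∷ 0<k′∷s) = begin
    lastD (replicate (suc k) c ++ E1 m n (complement c) (suc k′ ∷ s))
      ≡⟨ lastD-++-∷ (replicate (suc k) c) _ _ ⟩
    lastD (E1 m n (complement c) (suc k′ ∷ s))
      ≡⟨ lastD-E1 (complement c) (suc k′) s 0<k′∷s ⟩
    iter complement (length s) (complement c)
      ≡⟨ iter-shift complement (length s) c ⟩
    iter complement (length (suc k′ ∷ s)) c ∎

  C-∷ : ∀ c k s t → All (0 <_) (k ∷ s) →
    C m n (k ∷ s) (c ∷ t) ≡ iter complement (length (k ∷ s)) c ∷ C m n (E1 m n c (k ∷ s)) t
  C-∷ c k s t 0<k∷s = cong₂ _∷_
    (cong complement (lastD-E1 c k s 0<k∷s))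
    (trans (map-applyUpTo entry (λ i → suc (suc i)) (length t))
           (sym (map-applyUpTo entry′ suc (length t))))
    where
    entry entry′ : ℕ → ℕ
    entry  i = complement (lastD (E m n (k ∷ s) (take i (c ∷ t))))
    entry′ i = complement (lastD (E m n (E1 m n c (k ∷ s)) (take i t)))

module Letters (n : ℕ) (0<n : 0 < n) where

  open Expansion 1 n

  Letter : ℕ → Set
  Letter c = c ≡ 1 ⊎ c ≡ n

  Word : List ℕ → Set
  Word s = s ≢ [] × All Letter s

  letter-positive : ∀ {c} → Letter c → 0 < c
  letter-positive (inj₁ refl) = s≤s z≤n
  letter-positive (inj₂ refl) = 0<n

  complement-n : complement n ≡ 1
  complement-n = m+n∸n≡m 1 n

  complement-letter : ∀ {c} → Letter c → Letter (complement c)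
  complement-letter (inj₁ refl) = inj₂ refl
  complement-letter (inj₂ refl) = inj₁ complement-n

  complement-involutive : ∀ {c} → Letter c → complement (complement c) ≡ c
  complement-involutive (inj₁ refl) = complement-n
  complement-involutive (inj₂ refl) = cong complement complement-n

  iter-complement-letter : ∀ p {c} → Letter c → Letter (iter complement p c)
  iter-complement-letter zero    ℓ = ℓ
  iter-complement-letter (suc p) ℓ = complement-letter (iter-complement-letter p ℓ)

  iter-complement-1≡1⇔ : n ≢ 1 → ∀ p → iter complement p 1 ≡ 1 ⇔ parity p ≡ 0ℙ
  iter-complement-1≡1⇔ n≢1 zero          = mk⇔ (λ _ → refl) (λ _ → refl)
  iter-complement-1≡1⇔ n≢1 (suc zero)    = mk⇔ (λ n≡1 → contradiction n≡1 n≢1) (λ ())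
  iter-complement-1≡1⇔ n≢1 (suc (suc p))
    rewrite complement-involutive (iter-complement-letter p {1} (inj₁ refl)) =
      iter-complement-1≡1⇔ n≢1 p

  E1-letters : ∀ {c} → Letter c → ∀ s → All Letter (E1 1 n c s)
  E1-letters ℓ []      = []
  E1-letters ℓ (k ∷ s) = ++⁺ (replicate⁺ k ℓ) (E1-letters (complement-letter ℓ) s)

  E1-word : ∀ {c s} → Letter c → Word s → Word (E1 1 n c s)
  E1-word {s = []}    ℓ (s≢[] , _)    = contradiction refl s≢[]
  E1-word {c} {k ∷ s} ℓ (_ , ℓk ∷ _) = nonEmpty (letter-positive ℓk) , E1-letters ℓ (k ∷ s)
    where
    nonEmpty : 0 < k → E1 1 n c (k ∷ s) ≢ []
    nonEmpty (s≤s _) ()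

  C-∷-word : ∀ {s} c t → Word s →
    C 1 n s (c ∷ t) ≡ iter complement (length s) c ∷ C 1 n (E1 1 n c s) t
  C-∷-word {[]}    c t (s≢[] , _) = contradiction refl s≢[]
  C-∷-word {k ∷ s} c t (_ , ℓs)   = C-∷ c k s t (All.map letter-positive ℓs)

  C-letters : ∀ {s t} → Word s → All Letter t → All Letter (C 1 n s t)
  C-letters {s} {[]}    w []       = []
  C-letters {s} {c ∷ t} w (ℓ ∷ ℓt) rewrite C-∷-word c t w =
    iter-complement-letter (length s) ℓ ∷ C-letters (E1-word ℓ w) ℓt

  C-∷ʳ : ∀ {s u} c → Word s → All Letter u →
    C 1 n s (u ∷ʳ c) ≡ C 1 n s u ∷ʳ iter complement (length (E 1 n s u)) c
  C-∷ʳ {s} {[]}     c w []       = C-∷-word c [] w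
  C-∷ʳ {s} {c′ ∷ u} c w (ℓ ∷ ℓu) = begin
    C 1 n s (c′ ∷ u ∷ʳ c)                 ≡⟨ C-∷-word c′ (u ∷ʳ c) w ⟩
    c″ ∷ C 1 n (E1 1 n c′ s) (u ∷ʳ c)     ≡⟨ cong (c″ ∷_) (C-∷ʳ c (E1-word ℓ w) ℓu) ⟩
    c″ ∷ C 1 n (E1 1 n c′ s) u ∷ʳ c‴      ≡⟨ cong (_∷ʳ c‴) (C-∷-word c′ u w) ⟨
    C 1 n s (c′ ∷ u) ∷ʳ c‴                ∎
    where
    c″ c‴ : ℕ
    c″ = iter complement (length s) c′
    c‴ = iter complement (length (E 1 n s (c′ ∷ u))) c

  E-++ : ∀ {s t} s′ → Word s → All Letter t →
    E 1 n (s ++ s′) t ≡ E 1 n s t ++ E 1 n s′ (C 1 n s t)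
  E-++ {s} {[]}    s′ w []       = refl
  E-++ {s} {c ∷ t} s′ w (ℓ ∷ ℓt) = begin
    E 1 n (E1 1 n c (s ++ s′)) t
      ≡⟨ cong (λ x → E 1 n x t) (E1-++ c s s′) ⟩
    E 1 n (E1 1 n c s ++ E1 1 n c′ s′) t
      ≡⟨ E-++ (E1 1 n c′ s′) (E1-word ℓ w) ℓt ⟩
    E 1 n (E1 1 n c s) t ++ E 1 n s′ (c′ ∷ C 1 n (E1 1 n c s) t)
      ≡⟨ cong (λ x → E 1 n (E1 1 n c s) t ++ E 1 n s′ x) (C-∷-word c t w) ⟨
    E 1 n s (c ∷ t) ++ E 1 n s′ (C 1 n s (c ∷ t)) ∎
    where
    c′ : ℕ
    c′ = iter complement (length s) c

module Orbits (n : ℕ) (0<n : 0 < n) (n≢1 : n ≢ 1) where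

  open Expansion 1 n
  open Letters n 0<n

  T : List ℕ → List ℕ
  T = C 1 n (1 ∷ [])

  ones : ℕ → List ℕ
  ones k = replicate k 1

  word-1 : Word (1 ∷ [])
  word-1 = (λ ()) , inj₁ refl ∷ []

  ones-letters : ∀ k → All Letter (ones k)
  ones-letters k = replicate⁺ k (inj₁ refl)

  iter-T-letters : ∀ p {t} → All Letter t → All Letter (iter T p t)
  iter-T-letters zero    ℓt = ℓt
  iter-T-letters (suc p) ℓt = C-letters word-1 (iter-T-letters p ℓt)

  length-E-ones : ∀ N {t} → All Letter t →
    length (E 1 n (ones N) t) ≡ sumUpTo (λ q → length (E 1 n (1 ∷ []) (iter T q t))) N
  length-E-ones zero    {t} ℓt = cong length (E-[] t)
  length-E-ones (suc N) {t} ℓt = begin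
    length (E 1 n ((1 ∷ []) ++ ones N) t)
      ≡⟨ cong length (E-++ (ones N) word-1 ℓt) ⟩
    length (E 1 n (1 ∷ []) t ++ E 1 n (ones N) (T t))
      ≡⟨ length-++ (E 1 n (1 ∷ []) t) ⟩
    length (E 1 n (1 ∷ []) t) + length (E 1 n (ones N) (T t))
      ≡⟨ cong (length (E 1 n (1 ∷ []) t) +_) (length-E-ones N (C-letters word-1 ℓt)) ⟩
    length (E 1 n (1 ∷ []) t) + sumUpTo (λ q → length (E 1 n (1 ∷ []) (iter T q (T t)))) N
      ≡⟨ cong (length (E 1 n (1 ∷ []) t) +_)
              (sumUpTo-cong (λ q → cong (λ x → length (E 1 n (1 ∷ []) x)) (iter-shift T q t)) N) ⟩
    sumUpTo (λ q → length (E 1 n (1 ∷ []) (iter T q t))) (suc N) ∎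

  -- How often T, applied to T^q(1^k) followed by a letter, complements that letter.
  flips : ℕ → ℕ → ℕ
  flips k q = length (E 1 n (1 ∷ []) (iter T q (ones k)))

  iter-T-ones-suc : ∀ k p →
    iter T p (ones (suc k)) ≡ iter T p (ones k) ∷ʳ iter complement (sumUpTo (flips k) p) 1
  iter-T-ones-suc k zero    = replicate-suc-∷ʳ k 1
  iter-T-ones-suc k (suc p) = begin
    T (iter T p (ones (suc k)))
      ≡⟨ cong T (iter-T-ones-suc k p) ⟩
    T (iter T p (ones k) ∷ʳ iter complement (sumUpTo (flips k) p) 1)
      ≡⟨ C-∷ʳ _ word-1 (iter-T-letters p (ones-letters k)) ⟩
    iter T (suc p) (ones k) ∷ʳ iter complement (flips k p) (iter complement (sumUpTo (flips k) p) 1)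
      ≡⟨ cong (iter T (suc p) (ones k) ∷ʳ_) (iter-+ complement (flips k p) _ 1) ⟨
    iter T (suc p) (ones k) ∷ʳ iter complement (flips k p + sumUpTo (flips k) p) 1
      ≡⟨ cong (λ r → iter T (suc p) (ones k) ∷ʳ iter complement r 1)
              (trans (+-comm (flips k p) _) (sym (sumUpTo-suc (flips k) p))) ⟩
    iter T (suc p) (ones k) ∷ʳ iter complement (sumUpTo (flips k) (suc p)) 1 ∎

  returns-suc⇔ : ∀ k p → iter T p (ones (suc k)) ≡ ones (suc k) ⇔
    (iter T p (ones k) ≡ ones k × parity (sumUpTo (flips k) p) ≡ 0ℙ)
  returns-suc⇔ k p = mk⇔ to from
    where
    lastLetter⇔ : iter complement (sumUpTo (flips k) p) 1 ≡ 1 ⇔ parity (sumUpTo (flips k) p) ≡ 0ℙ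
    lastLetter⇔ = iter-complement-1≡1⇔ n≢1 (sumUpTo (flips k) p)
    to : iter T p (ones (suc k)) ≡ ones (suc k) →
      iter T p (ones k) ≡ ones k × parity (sumUpTo (flips k) p) ≡ 0ℙ
    to returns with ∷ʳ-injective (iter T p (ones k)) (ones k)
                      (trans (sym (iter-T-ones-suc k p)) (trans returns (replicate-suc-∷ʳ k 1)))
    ... | init≡ , last≡ = init≡ , Equivalence.to lastLetter⇔ last≡
    from : iter T p (ones k) ≡ ones k × parity (sumUpTo (flips k) p) ≡ 0ℙ →
      iter T p (ones (suc k)) ≡ ones (suc k)
    from (init≡ , even) = trans (iter-T-ones-suc k p)
      (trans (cong₂ _∷ʳ_ init≡ (Equivalence.from lastLetter⇔ even)) (sym (replicate-suc-∷ʳ k 1)))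

  period : ℕ → ℕ
  flipParity : ℕ → Parity

  period zero    = 1
  period (suc k) = scale (flipParity k) (period k)

  flipParity k = parity (sumUpTo (flips k) (period k))

  flips-periodic : ∀ k P → iter T P (ones k) ≡ ones k → ∀ q → flips k (P + q) ≡ flips k q
  flips-periodic k P returns q = cong (λ x → length (E 1 n (1 ∷ []) x)) (iter-periodic P returns q)

  returns⇔ : ∀ k p → iter T p (ones k) ≡ ones k ⇔ period k ∣ p
  returns⇔ zero    p = mk⇔ (λ _ → 1∣ p) (λ _ → iter-T-[] p)
    where
    iter-T-[] : ∀ p → iter T p [] ≡ []
    iter-T-[] zero    = refl
    iter-T-[] (suc p) = cong T (iter-T-[] p)
  returns⇔ (suc k) p =
    ⇔-trans (returns-suc⇔ k p)
            (⇔-trans (returns⇔ k p ×-⇔ ⇔-refl)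
                     (multiple-with-even-sum⇔ (flips-periodic k (period k) returnsAtPeriod) p))
    where
    returnsAtPeriod : iter T (period k) (ones k) ≡ ones k
    returnsAtPeriod = Equivalence.from (returns⇔ k (period k)) ∣-refl

  period-positive : ∀ k → 0 < period k
  period-positive zero    = s≤s z≤n
  period-positive (suc k) with flipParity k
  ... | 0ℙ = period-positive k
  ... | 1ℙ = <-≤-trans (period-positive k) (m≤m+n (period k) _)

  orbitLength-ones⇔ : ∀ k L → OrbitLength T (ones k) L ⇔ L ≡ period k
  orbitLength-ones⇔ k = orbitLength⇔ (period-positive k) (returns⇔ k)

  flips-suc : ∀ k q → flips (suc k) q ≡ sum (E 1 n (1 ∷ []) (iter T q (ones k)))
  flips-suc k q = begin
    length (E 1 n (1 ∷ []) (iter T q (ones (suc k))))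
      ≡⟨ cong (λ x → length (E 1 n (1 ∷ []) x)) (iter-T-ones-suc k q) ⟩
    length (E 1 n (1 ∷ []) (iter T q (ones k) ∷ʳ c))
      ≡⟨ cong length (E-∷ʳ (1 ∷ []) (iter T q (ones k)) c) ⟩
    length (E1 1 n c (E 1 n (1 ∷ []) (iter T q (ones k))))
      ≡⟨ length-E1 c (E 1 n (1 ∷ []) (iter T q (ones k))) ⟩
    sum (E 1 n (1 ∷ []) (iter T q (ones k))) ∎
    where
    c : ℕ
    c = iter complement (sumUpTo (flips k) q) 1

  flipParity-suc : ∀ k → flipParity k ≡ 1ℙ → flipParity (suc k) ≡ 0ℙ
  flipParity-suc k odd rewrite odd =
    parity-sumUpTo-periodic {flips (suc k)} {period k} flips-suc-periodic 2
    where
    returns : iter T (period k) (ones k) ≡ ones k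
    returns = Equivalence.from (returns⇔ k (period k)) ∣-refl
    flips-suc-periodic : ∀ q → flips (suc k) (period k + q) ≡ flips (suc k) q
    flips-suc-periodic q = begin
      flips (suc k) (period k + q)
        ≡⟨ flips-suc k (period k + q) ⟩
      sum (E 1 n (1 ∷ []) (iter T (period k + q) (ones k)))
        ≡⟨ cong (λ x → sum (E 1 n (1 ∷ []) x)) (iter-periodic (period k) returns q) ⟩
      sum (E 1 n (1 ∷ []) (iter T q (ones k)))
        ≡⟨ flips-suc k q ⟨
      flips (suc k) q ∎

  flipParity≡parity-length : ∀ k N → period k ≡ N →
    flipParity k ≡ parity (length (E 1 n (ones N) (ones k)))
  flipParity≡parity-length k N refl = cong parity (sym (length-E-ones N (ones-letters k)))

  Doubling : ℕ → Set
  Doubling j = flipParity (2 * j) ≡ 1ℙ × period (2 * j) ≡ 2 ^ j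

  doubling-zero : Doubling 0
  doubling-zero = refl , refl

  periods-after-doubling : ∀ j → Doubling j →
    period (suc (2 * j)) ≡ 2 ^ suc j × period (2 * suc j) ≡ 2 ^ suc j
  periods-after-doubling j (odd , period≡) = oddPeriod , (begin
    period (2 * suc j)
      ≡⟨ cong period (*-suc 2 j) ⟩
    period (suc (suc (2 * j)))
      ≡⟨ cong (λ d → scale d (period (suc (2 * j)))) (flipParity-suc (2 * j) odd) ⟩
    period (suc (2 * j))
      ≡⟨ oddPeriod ⟩
    2 ^ suc j ∎)
    where
    oddPeriod : period (suc (2 * j)) ≡ 2 ^ suc j
    oddPeriod = cong₂ scale odd period≡

  odd-index : ∀ j → 2 * suc j ∸ 1 ≡ suc (2 * j)
  odd-index j = cong (_∸ 1) (*-suc 2 j)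

  doubling⇒orbitLength : ∀ j → Doubling j → OrbitLength T (ones (2 * suc j ∸ 1)) (2 ^ suc j)
  doubling⇒orbitLength j d = subst (λ k → OrbitLength T (ones k) (2 ^ suc j)) (sym (odd-index j))
    (Equivalence.from (orbitLength-ones⇔ (suc (2 * j)) (2 ^ suc j))
                      (sym (proj₁ (periods-after-doubling j d))))

  doubling⇒odd-length : ∀ j → Doubling j → ¬ 2 ∣ length (E 1 n (ones (2 ^ j)) (ones (2 * j)))
  doubling⇒odd-length j (odd , period≡) 2∣ with () ←
    trans (sym odd) (trans (flipParity≡parity-length (2 * j) (2 ^ j) period≡) (2∣⇒parity≡0ℙ 2∣))

  doubling-suc-of-orbitLength : ∀ j → Doubling j →
    OrbitLength T (ones (2 * suc (suc j) ∸ 1)) (2 ^ suc (suc j)) → Doubling (suc j)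
  doubling-suc-of-orbitLength j d orbit = flipParity≡1ℙ , period≡
    where
    period≡ : period (2 * suc j) ≡ 2 ^ suc j
    period≡ = proj₂ (periods-after-doubling j d)
    grows : 2 ^ suc (suc j) ≡ scale (flipParity (2 * suc j)) (2 ^ suc j)
    grows = trans (Equivalence.to (orbitLength-ones⇔ (suc (2 * suc j)) (2 ^ suc (suc j)))
                    (subst (λ k → OrbitLength T (ones k) (2 ^ suc (suc j))) (odd-index (suc j)) orbit))
                  (cong (scale (flipParity (2 * suc j))) period≡)
    flipParity≡1ℙ : flipParity (2 * suc j) ≡ 1ℙ
    flipParity≡1ℙ with flipParity (2 * suc j) | grows
    ... | 1ℙ | _             = refl
    ... | 0ℙ | 2^[2+j]≡2^[1+j] =
      contradiction 2^[2+j]≡2^[1+j] (>⇒≢ (^-monoʳ-< 2 (s≤s (s≤s z≤n)) (n<1+n (suc j))))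

  doubling-suc-of-odd-length : ∀ j → Doubling j →
    ¬ 2 ∣ length (E 1 n (ones (2 ^ suc j)) (ones (2 * suc j))) → Doubling (suc j)
  doubling-suc-of-odd-length j d odd =
    trans (flipParity≡parity-length (2 * suc j) (2 ^ suc j) period≡) (¬2∣⇒parity≡1ℙ odd) , period≡
    where
    period≡ : period (2 * suc j) ≡ 2 ^ suc j
    period≡ = proj₂ (periods-after-doubling j d)

  doubling-of-orbitLengths : (∀ j → 0 < j → OrbitLength T (ones (2 * j ∸ 1)) (2 ^ j)) →
    ∀ j → Doubling j
  doubling-of-orbitLengths orbits zero    = doubling-zero
  doubling-of-orbitLengths orbits (suc j) =
    doubling-suc-of-orbitLength j (doubling-of-orbitLengths orbits j) (orbits (suc (suc j)) (s≤s z≤n))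

  doubling-of-odd-lengths : (∀ j → 0 < j → ¬ 2 ∣ length (E 1 n (ones (2 ^ j)) (ones (2 * j)))) →
    ∀ j → Doubling j
  doubling-of-odd-lengths odd zero    = doubling-zero
  doubling-of-odd-lengths odd (suc j) =
    doubling-suc-of-odd-length j (doubling-of-odd-lengths odd j) (odd (suc j) (s≤s z≤n))

proposition3p5 : (n : ℕ) → 0 < n → 2 ∣ n →
    ((∀ (j : ℕ) → 0 < j → OrbitLength (C 1 n (1 ∷ [])) (replicate (2 * j ∸ 1) 1) (2 ^ j))
      → (∀ (j : ℕ) → 0 < j → ¬ (2 ∣ length (E 1 n (replicate (2 ^ j) 1) (replicate (2 * j) 1)))))
    × ((∀ (j : ℕ) → 0 < j → ¬ (2 ∣ length (E 1 n (replicate (2 ^ j) 1) (replicate (2 * j) 1))))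
      → (∀ (j : ℕ) → 0 < j → OrbitLength (C 1 n (1 ∷ [])) (replicate (2 * j ∸ 1) 1) (2 ^ j)))
proposition3p5 n 0<n 2∣n =
  (λ orbits j _ → doubling⇒odd-length j (doubling-of-orbitLengths orbits j)) ,
  λ where odd (suc j) _ → doubling⇒orbitLength j (doubling-of-odd-lengths odd j)
  where
  n≢1 : n ≢ 1
  n≢1 n≡1 with () ← 2∣⇒parity≡0ℙ (subst (2 ∣_) n≡1 2∣n)
  open Orbits n 0<n n≢1
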